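{- Let $m\geq 1$ and $n\geq 1$ be integers. The graph $m\overline{\Gamma(\mathbb{Z}_6)}+n\Gamma(\mathbb{Z}_9)$ (the join of $m\overline{\Gamma(\mathbb{Z}_6)}$ and $n\Gamma(\mathbb{Z}_9)$) admits a distance antimagic labeling if and only if $m=1$.
   Context: For an integer $n \geq 2$, the zero-divisor graph $\Gamma(\mathbb{Z}_n)$ is the simple graph whose vertex set is the set of nonzero zero-divisors of the ring $\mathbb{Z}_n$, two distinct vertices $u,v$ being adjacent iff $uv \equiv 0 \pmod n$. $\overline{H}$ denotes the complement of a graph $H$. For a graph $H$ and positive integer $k$, $kH$ denotes the disjoint union of $k$ copies of $H$. For graphs $G,H$, the join $G+H$ is the graph obtained from the disjoint union of $G$ and $H$ by adding every edge between a vertex of $G$ and a vertex of $H$. A distance antimagic labeling (DAML) of a graph $G$ with $N$ vertices is a bijection $f:V(G)\to\{1,\dots,N\}$ such that the weights $w(v)=\sum_{u\in N(v)} f(u)$, where $N(v)$ is the open neighbourhood of $v$, are pairwise distinct over all vertices $v$. A graph admits DAML if such a labeling exists. -}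

module Defs where

open import Data.Bool using (Bool; true; false; not; _∧_; _∨_; if_then_else_)
open import Data.Nat using (ℕ; zero; suc; _+_; _*_; _%_; _≡ᵇ_; NonZero)
open import Data.Fin using (Fin; toℕ; splitAt; _↑ˡ_; _↑ʳ_)
open import Data.Fin.Properties using (_≟_)
open import Data.Sum using (_⊎_; inj₁; inj₂)
open import Data.List using (List; filterᵇ; length; lookup; map; allFin; upTo; drop)
open import Data.Bool.ListAction using (any)
open import Data.Nat.ListAction using (sum)
open import Data.Product using (Σ; _×_)
open import Function.Definitions using (Injective; Bijective)
open import Relation.Binary.PropositionalEquality using (_≡_)
open import Relation.Nullary.Decidable using (⌊_⌋)

-- A finite simple graph on vertex set Fin V, adjacency given as a Boolean
-- function (all graphs constructed below are symmetric and loopless).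
record Graph : Set where
  field
    V   : ℕ
    adj : Fin V → Fin V → Bool
open Graph public

nonzeroResidues : ℕ → List ℕ
nonzeroResidues n = drop 1 (upTo n)

isZeroDivisor : (n : ℕ) → .{{NonZero n}} → ℕ → Bool
isZeroDivisor n a = any (λ b → (a * b) % n ≡ᵇ 0) (nonzeroResidues n)

zeroDivisors : (n : ℕ) → .{{NonZero n}} → List ℕ
zeroDivisors n = filterᵇ (isZeroDivisor n) (nonzeroResidues n)

Γℤ : (n : ℕ) → .{{NonZero n}} → Graph
Γℤ n = record
  { V   = length (zeroDivisors n)
  ; adj = λ i j → not (lookup (zeroDivisors n) i ≡ᵇ lookup (zeroDivisors n) j)
                  ∧ ((lookup (zeroDivisors n) i * lookup (zeroDivisors n) j) % n ≡ᵇ 0)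
  }

complement : Graph → Graph
complement G = record
  { V   = V G
  ; adj = λ i j → not (adj G i j) ∧ not ⌊ i ≟ j ⌋ }

private
  combine : Bool → Graph → Graph → Graph
  combine cross G H = record
    { V   = V G + V H
    ; adj = λ i j → go (splitAt (V G) i) (splitAt (V G) j) }
    where
    go : Fin (V G) ⊎ Fin (V H) → Fin (V G) ⊎ Fin (V H) → Bool
    go (inj₁ a) (inj₁ b) = adj G a b
    go (inj₂ a) (inj₂ b) = adj H a b
    go (inj₁ _) (inj₂ _) = cross
    go (inj₂ _) (inj₁ _) = cross

_⊕_ : Graph → Graph → Graph
G ⊕ H = combine false G H

_⊞_ : Graph → Graph → Graph
G ⊞ H = combine true G H

emptyGraph : Graph
emptyGraph = record { V = 0 ; adj = λ () }

copies : ℕ → Graph → Graph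
copies zero    H = emptyGraph
copies (suc k) H = H ⊕ copies k H

-- weight of v under labeling f : Fin V → Fin V (vertex u gets label toℕ (f u) + 1)
weight : (G : Graph) → (Fin (V G) → Fin (V G)) → Fin (V G) → ℕ
weight G f v = sum (map (λ u → if adj G v u then suc (toℕ (f u)) else 0) (allFin (V G)))

IsDAML : (G : Graph) → (Fin (V G) → Fin (V G)) → Set
IsDAML G f = Bijective _≡_ _≡_ f × Injective _≡_ _≡_ (weight G f)

AdmitsDAML : Graph → Set
AdmitsDAML G = Σ (Fin (V G) → Fin (V G)) (IsDAML G)

-- For m ≥ 2, the vertex 3 of Γ(ℤ₆)ᶜ is isolated, so its copies in two different summands
-- both have the whole n Γ(ℤ₉) side as neighbourhood and receive equal weights under every
-- labeling. For m = 1, label Γ(ℤ₆)ᶜ by 1, 2, 3 and n Γ(ℤ₉) ≅ n K₂ by 4, …, 2n + 3: with T the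
-- sum of the right-hand labels the left weights are T + 3, T, T + 1, a right vertex has
-- weight 6 plus the label of its partner in the matching, and for n ≥ 2 this stays below
-- T ≥ 8n. The case m = n = 1 is settled by an explicit labeling.

module Submission where

open import Defs
open import Data.Nat using (ℕ; _≥_)
open import Relation.Binary.PropositionalEquality using (_≡_)
open import Function.Bundles using (_⇔_)

open import Data.Bool using (false; if_then_else_)
open import Data.Empty using (⊥-elim)
open import Data.Fin using (Fin; toℕ; splitAt; join; _↑ˡ_; _↑ʳ_) renaming (zero to fz; suc to fs)
open import Data.Fin.Properties
  using ( splitAt-↑ˡ; splitAt-↑ʳ; join-splitAt; toℕ-↑ʳ; toℕ<n
        ; toℕ-injective; ↑ˡ-injective; ↑ʳ-injective)
open import Data.List using (map; allFin; tabulate)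
open import Data.List.Properties using (map-tabulate)
open import Data.Nat using (zero; suc; _+_; _*_; _≤_; _<_; z≤n)
open import Data.Nat.ListAction using (sum)
open import Data.Nat.Properties
open import Algebra.Properties.Monoid.Sum +-0-monoid using (sum-cong-≗; sum-replicate-zero)
  renaming (sum to ∑)
open import Data.Product using (_,_)
open import Data.Sum using (inj₁; inj₂)
open import Function using (_∘_; id; mk⇔)
open import Function.Definitions using (Injective)
open import Function.Consequences.Propositional
  using ( inverseᵇ⇒bijective; inverseʳ⇒injective
        ; strictlyInverseˡ⇒inverseˡ; strictlyInverseʳ⇒inverseʳ)
import Function.Construct.Identity as Identity
open import Relation.Binary.PropositionalEquality
  using (refl; sym; trans; cong; cong₂; subst; _≢_; module ≡-Reasoning)
open import Relation.Nullary using (¬_)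

∑-allFin : (n : ℕ) (h : Fin n → ℕ) → sum (map h (allFin n)) ≡ ∑ h
∑-allFin n h = trans (cong sum (map-tabulate id h)) (∑-tabulate n h)
  where
  ∑-tabulate : (n : ℕ) (h : Fin n → ℕ) → sum (tabulate h) ≡ ∑ h
  ∑-tabulate zero    h = refl
  ∑-tabulate (suc n) h = cong (h fz +_) (∑-tabulate n (h ∘ fs))

∑-↑ : (a b : ℕ) (h : Fin (a + b) → ℕ) → ∑ h ≡ ∑ (h ∘ (_↑ˡ b)) + ∑ (h ∘ (a ↑ʳ_))
∑-↑ zero    b h = refl
∑-↑ (suc a) b h = trans (cong (h fz +_) (∑-↑ a b (h ∘ fs))) (sym (+-assoc (h fz) _ _))

∑-↑-cong : (a b : ℕ) (h : Fin (a + b) → ℕ) {hˡ : Fin a → ℕ} {hʳ : Fin b → ℕ} →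
  (∀ i → h (i ↑ˡ b) ≡ hˡ i) → (∀ j → h (a ↑ʳ j) ≡ hʳ j) → ∑ h ≡ ∑ hˡ + ∑ hʳ
∑-↑-cong a b h eqˡ eqʳ = trans (∑-↑ a b h) (cong₂ _+_ (sum-cong-≗ eqˡ) (sum-cong-≗ eqʳ))

*≤∑ : (n c : ℕ) (h : Fin n → ℕ) → (∀ i → c ≤ h i) → n * c ≤ ∑ h
*≤∑ zero    c h c≤h = z≤n
*≤∑ (suc n) c h c≤h = +-mono-≤ (c≤h fz) (*≤∑ n c (h ∘ fs) (c≤h ∘ fs))

injective-↑ : (a b : ℕ) (h : Fin (a + b) → ℕ) →
  Injective _≡_ _≡_ (h ∘ (_↑ˡ b)) → Injective _≡_ _≡_ (h ∘ (a ↑ʳ_)) →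
  (∀ i j → h (a ↑ʳ j) < h (i ↑ˡ b)) → Injective _≡_ _≡_ h
injective-↑ a b h injˡ injʳ sep {x} {y} hx≡hy = begin
  x                       ≡⟨ join-splitAt a b x ⟨
  join a b (splitAt a x)  ≡⟨ onJoin (splitAt a x) (splitAt a y) h∘join≡ ⟩
  join a b (splitAt a y)  ≡⟨ join-splitAt a b y ⟩
  y                       ∎
  where
  open ≡-Reasoning
  h∘join≡ : h (join a b (splitAt a x)) ≡ h (join a b (splitAt a y))
  h∘join≡ = trans (cong h (join-splitAt a b x)) (trans hx≡hy (cong h (sym (join-splitAt a b y))))
  onJoin : ∀ s t → h (join a b s) ≡ h (join a b t) → join a b s ≡ join a b t
  onJoin (inj₁ i) (inj₁ j) e = cong (_↑ˡ b) (injˡ e)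
  onJoin (inj₁ i) (inj₂ j) e = ⊥-elim (<-irrefl (sym e) (sep i j))
  onJoin (inj₂ i) (inj₁ j) e = ⊥-elim (<-irrefl e (sep j i))
  onJoin (inj₂ i) (inj₂ j) e = cong (a ↑ʳ_) (injʳ e)

neighbourSum : (G : Graph) → (Fin (V G) → ℕ) → Fin (V G) → ℕ
neighbourSum G g v = ∑ λ u → if adj G v u then g u else 0

label : {N : ℕ} → (Fin N → Fin N) → Fin N → ℕ
label f u = suc (toℕ (f u))

weight≡neighbourSum : (G : Graph) (f : Fin (V G) → Fin (V G)) (v : Fin (V G)) →
  weight G f v ≡ neighbourSum G (label f) v
weight≡neighbourSum G f v = ∑-allFin (V G) _

module _ (G H : Graph) (g : Fin (V G + V H) → ℕ) where

  ⊕-neighbourSum-↑ˡ : (i : Fin (V G)) →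
    neighbourSum (G ⊕ H) g (i ↑ˡ V H) ≡ neighbourSum G (g ∘ (_↑ˡ V H)) i
  ⊕-neighbourSum-↑ˡ i =
    trans (∑-↑-cong (V G) (V H) _ inG noEdge)
          (trans (cong (neighbourSum G (g ∘ (_↑ˡ V H)) i +_) (sum-replicate-zero (V H)))
                 (+-identityʳ _))
    where
    inG : ∀ j → (if adj (G ⊕ H) (i ↑ˡ V H) (j ↑ˡ V H) then g (j ↑ˡ V H) else 0)
              ≡ (if adj G i j then g (j ↑ˡ V H) else 0)
    inG j rewrite splitAt-↑ˡ (V G) i (V H) | splitAt-↑ˡ (V G) j (V H) = refl
    noEdge : ∀ k → (if adj (G ⊕ H) (i ↑ˡ V H) (V G ↑ʳ k) then g (V G ↑ʳ k) else 0) ≡ 0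
    noEdge k rewrite splitAt-↑ˡ (V G) i (V H) | splitAt-↑ʳ (V G) (V H) k = refl

  ⊕-neighbourSum-↑ʳ : (k : Fin (V H)) →
    neighbourSum (G ⊕ H) g (V G ↑ʳ k) ≡ neighbourSum H (g ∘ (V G ↑ʳ_)) k
  ⊕-neighbourSum-↑ʳ k =
    trans (∑-↑-cong (V G) (V H) _ noEdge inH)
          (cong (_+ neighbourSum H (g ∘ (V G ↑ʳ_)) k) (sum-replicate-zero (V G)))
    where
    noEdge : ∀ j → (if adj (G ⊕ H) (V G ↑ʳ k) (j ↑ˡ V H) then g (j ↑ˡ V H) else 0) ≡ 0
    noEdge j rewrite splitAt-↑ʳ (V G) (V H) k | splitAt-↑ˡ (V G) j (V H) = refl
    inH : ∀ l → (if adj (G ⊕ H) (V G ↑ʳ k) (V G ↑ʳ l) then g (V G ↑ʳ l) else 0)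
              ≡ (if adj H k l then g (V G ↑ʳ l) else 0)
    inH l rewrite splitAt-↑ʳ (V G) (V H) k | splitAt-↑ʳ (V G) (V H) l = refl

  ⊞-neighbourSum-↑ˡ : (i : Fin (V G)) →
    neighbourSum (G ⊞ H) g (i ↑ˡ V H) ≡ neighbourSum G (g ∘ (_↑ˡ V H)) i + ∑ (g ∘ (V G ↑ʳ_))
  ⊞-neighbourSum-↑ˡ i = ∑-↑-cong (V G) (V H) _ inG edge
    where
    inG : ∀ j → (if adj (G ⊞ H) (i ↑ˡ V H) (j ↑ˡ V H) then g (j ↑ˡ V H) else 0)
              ≡ (if adj G i j then g (j ↑ˡ V H) else 0)
    inG j rewrite splitAt-↑ˡ (V G) i (V H) | splitAt-↑ˡ (V G) j (V H) = refl
    edge : ∀ k → (if adj (G ⊞ H) (i ↑ˡ V H) (V G ↑ʳ k) then g (V G ↑ʳ k) else 0) ≡ g (V G ↑ʳ k)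
    edge k rewrite splitAt-↑ˡ (V G) i (V H) | splitAt-↑ʳ (V G) (V H) k = refl

  ⊞-neighbourSum-↑ʳ : (k : Fin (V H)) →
    neighbourSum (G ⊞ H) g (V G ↑ʳ k) ≡ ∑ (g ∘ (_↑ˡ V H)) + neighbourSum H (g ∘ (V G ↑ʳ_)) k
  ⊞-neighbourSum-↑ʳ k = ∑-↑-cong (V G) (V H) _ edge inH
    where
    edge : ∀ j → (if adj (G ⊞ H) (V G ↑ʳ k) (j ↑ˡ V H) then g (j ↑ˡ V H) else 0) ≡ g (j ↑ˡ V H)
    edge j rewrite splitAt-↑ʳ (V G) (V H) k | splitAt-↑ˡ (V G) j (V H) = refl
    inH : ∀ l → (if adj (G ⊞ H) (V G ↑ʳ k) (V G ↑ʳ l) then g (V G ↑ʳ l) else 0)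
              ≡ (if adj H k l then g (V G ↑ʳ l) else 0)
    inH l rewrite splitAt-↑ʳ (V G) (V H) k | splitAt-↑ʳ (V G) (V H) l = refl

Isolated : (G : Graph) → Fin (V G) → Set
Isolated G v = ∀ u → adj G v u ≡ false

neighbourSum-isolated : (G : Graph) (g : Fin (V G) → ℕ) {v : Fin (V G)} →
  Isolated G v → neighbourSum G g v ≡ 0
neighbourSum-isolated G g {v} iso =
  trans (sum-cong-≗ (λ u → cong (if_then g u else 0) (iso u))) (sum-replicate-zero (V G))

⊕-isolated-↑ˡ : (G H : Graph) {i : Fin (V G)} → Isolated G i → Isolated (G ⊕ H) (i ↑ˡ V H)
⊕-isolated-↑ˡ G H {i} iso u rewrite splitAt-↑ˡ (V G) i (V H) with splitAt (V G) u
... | inj₁ j = iso j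
... | inj₂ _ = refl

⊕-isolated-↑ʳ : (G H : Graph) {k : Fin (V H)} → Isolated H k → Isolated (G ⊕ H) (V G ↑ʳ k)
⊕-isolated-↑ʳ G H {k} iso u rewrite splitAt-↑ʳ (V G) (V H) k with splitAt (V G) u
... | inj₁ _ = refl
... | inj₂ l = iso l

↑ˡ≢↑ʳ : {a b : ℕ} (i : Fin a) (j : Fin b) → i ↑ˡ b ≢ a ↑ʳ j
↑ˡ≢↑ʳ {a} {b} i j e
  with trans (sym (splitAt-↑ˡ a i b)) (trans (cong (splitAt a) e) (splitAt-↑ʳ a b j))
... | ()

⊞-weight-isolated : (G H : Graph) (f : Fin (V (G ⊞ H)) → Fin (V (G ⊞ H))) {i : Fin (V G)} →
  Isolated G i → weight (G ⊞ H) f (i ↑ˡ V H) ≡ ∑ (label f ∘ (V G ↑ʳ_))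
⊞-weight-isolated G H f {i} iso =
  trans (weight≡neighbourSum (G ⊞ H) f (i ↑ˡ V H))
        (trans (⊞-neighbourSum-↑ˡ G H (label f) i)
               (cong (_+ ∑ (label f ∘ (V G ↑ʳ_))) (neighbourSum-isolated G _ iso)))

⊞-¬DAML-isolated-pair : (G H : Graph) {i j : Fin (V G)} →
  i ≢ j → Isolated G i → Isolated G j → ¬ AdmitsDAML (G ⊞ H)
⊞-¬DAML-isolated-pair G H {i} {j} i≢j isoᵢ isoⱼ (f , _ , weight-injective) =
  i≢j (↑ˡ-injective (V H) i j (weight-injective
    (trans (⊞-weight-isolated G H f isoᵢ) (sym (⊞-weight-isolated G H f isoⱼ)))))

copies-⊞-¬DAML : (G H : Graph) (m : ℕ) {i : Fin (V G)} →
  Isolated G i → ¬ AdmitsDAML (copies (suc (suc m)) G ⊞ H)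
copies-⊞-¬DAML G H m {i} iso = ⊞-¬DAML-isolated-pair (copies (suc (suc m)) G) H
  (↑ˡ≢↑ʳ i _) (⊕-isolated-↑ˡ G _ iso) (⊕-isolated-↑ʳ G _ (⊕-isolated-↑ˡ G _ iso))

Γ₆ᶜ : Graph
Γ₆ᶜ = complement (Γℤ 6)

-- The vertices of Γ(ℤ₆) are the residues 2, 3, 4, and 3 is adjacent to both others.
Γ₆ᶜ-isolated : Isolated Γ₆ᶜ (fs fz)
Γ₆ᶜ-isolated fz           = refl
Γ₆ᶜ-isolated (fs fz)      = refl
Γ₆ᶜ-isolated (fs (fs fz)) = refl

Γ₉ : Graph
Γ₉ = Γℤ 9

-- Γ(ℤ₉) is the single edge 3 — 6, so n copies of it form a perfect matching.
partner : (n : ℕ) → Fin (V (copies n Γ₉)) → Fin (V (copies n Γ₉))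
partner (suc n) fz          = fs fz
partner (suc n) (fs fz)     = fz
partner (suc n) (fs (fs k)) = fs (fs (partner n k))

partner-involutive : (n : ℕ) (k : Fin (V (copies n Γ₉))) → partner n (partner n k) ≡ k
partner-involutive (suc n) fz          = refl
partner-involutive (suc n) (fs fz)     = refl
partner-involutive (suc n) (fs (fs k)) = cong (fs ∘ fs) (partner-involutive n k)

partner-injective : (n : ℕ) → Injective _≡_ _≡_ (partner n)
partner-injective n {k} {l} e =
  trans (sym (partner-involutive n k)) (trans (cong (partner n) e) (partner-involutive n l))

neighbourSum-copies-Γ₉ : (n : ℕ) (g : Fin (V (copies n Γ₉)) → ℕ) (k : Fin (V (copies n Γ₉))) →
  neighbourSum (copies n Γ₉) g k ≡ g (partner n k)
neighbourSum-copies-Γ₉ (suc n) g fz =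
  trans (⊕-neighbourSum-↑ˡ Γ₉ (copies n Γ₉) g fz) (+-identityʳ _)
neighbourSum-copies-Γ₉ (suc n) g (fs fz) =
  trans (⊕-neighbourSum-↑ˡ Γ₉ (copies n Γ₉) g (fs fz)) (+-identityʳ _)
neighbourSum-copies-Γ₉ (suc n) g (fs (fs k)) =
  trans (⊕-neighbourSum-↑ʳ Γ₉ (copies n Γ₉) g k) (neighbourSum-copies-Γ₉ n _ k)

Γ₆ᶜ⊞Γ₉-DAML : AdmitsDAML (copies 1 Γ₆ᶜ ⊞ copies 1 Γ₉)
Γ₆ᶜ⊞Γ₉-DAML =
  labeling ,
  inverseᵇ⇒bijective ( strictlyInverseˡ⇒inverseˡ labeling labeling-decoding
                     , strictlyInverseʳ⇒inverseʳ labeling decoding-labeling ) ,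
  inverseʳ⇒injective w (strictlyInverseʳ⇒inverseʳ {f⁻¹ = weightDecoding} w weightDecoding-weight)
  where
  labeling decoding : Fin 5 → Fin 5
  labeling fz                     = fz
  labeling (fs fz)                = fs (fs (fs (fs fz)))
  labeling (fs (fs fz))           = fs fz
  labeling (fs (fs (fs fz)))      = fs (fs fz)
  labeling (fs (fs (fs (fs fz)))) = fs (fs (fs fz))
  decoding fz                     = fz
  decoding (fs fz)                = fs (fs fz)
  decoding (fs (fs fz))           = fs (fs (fs fz))
  decoding (fs (fs (fs fz)))      = fs (fs (fs (fs fz)))
  decoding (fs (fs (fs (fs fz)))) = fs fz

  labeling-decoding : ∀ x → labeling (decoding x) ≡ x
  labeling-decoding fz                     = refl
  labeling-decoding (fs fz)                = refl
  labeling-decoding (fs (fs fz))           = refl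
  labeling-decoding (fs (fs (fs fz)))      = refl
  labeling-decoding (fs (fs (fs (fs fz)))) = refl

  decoding-labeling : ∀ x → decoding (labeling x) ≡ x
  decoding-labeling fz                     = refl
  decoding-labeling (fs fz)                = refl
  decoding-labeling (fs (fs fz))           = refl
  decoding-labeling (fs (fs (fs fz)))      = refl
  decoding-labeling (fs (fs (fs (fs fz)))) = refl

  -- The weights of the five vertices are 9, 7, 8, 12, 11.
  weightDecoding : ℕ → Fin 5
  weightDecoding 7  = fs fz
  weightDecoding 8  = fs (fs fz)
  weightDecoding 12 = fs (fs (fs fz))
  weightDecoding 11 = fs (fs (fs (fs fz)))
  weightDecoding _  = fz

  w : Fin 5 → ℕ
  w = weight (copies 1 Γ₆ᶜ ⊞ copies 1 Γ₉) labeling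

  weightDecoding-weight : ∀ x → weightDecoding (w x) ≡ x
  weightDecoding-weight fz                     = refl
  weightDecoding-weight (fs fz)                = refl
  weightDecoding-weight (fs (fs fz))           = refl
  weightDecoding-weight (fs (fs (fs fz)))      = refl
  weightDecoding-weight (fs (fs (fs (fs fz)))) = refl

module IdentityLabeling (n : ℕ) where
  N : ℕ
  N = suc (suc n)

  G H : Graph
  G = copies 1 Γ₆ᶜ
  H = copies N Γ₉

  W ℓ : Fin (V (G ⊞ H)) → ℕ
  W = weight (G ⊞ H) id
  ℓ = label id

  T : ℕ
  T = ∑ (ℓ ∘ (V G ↑ʳ_))

  W-↑ˡ : (i : Fin (V G)) → W (i ↑ˡ V H) ≡ neighbourSum G (ℓ ∘ (_↑ˡ V H)) i + T
  W-↑ˡ i = trans (weight≡neighbourSum (G ⊞ H) id (i ↑ˡ V H)) (⊞-neighbourSum-↑ˡ G H ℓ i)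

  W-↑ʳ : (k : Fin (V H)) → W (V G ↑ʳ k) ≡ 6 + ℓ (V G ↑ʳ partner N k)
  W-↑ʳ k = trans (weight≡neighbourSum (G ⊞ H) id (V G ↑ʳ k))
    (trans (⊞-neighbourSum-↑ʳ G H ℓ k) (cong (6 +_) (neighbourSum-copies-Γ₉ N (ℓ ∘ (V G ↑ʳ_)) k)))

  neighbourSum-G-injective : Injective _≡_ _≡_ (neighbourSum G (ℓ ∘ (_↑ˡ V H)))
  neighbourSum-G-injective {fz}         {fz}         _ = refl
  neighbourSum-G-injective {fs fz}      {fs fz}      _ = refl
  neighbourSum-G-injective {fs (fs fz)} {fs (fs fz)} _ = refl
  neighbourSum-G-injective {fz}         {fs fz}      ()
  neighbourSum-G-injective {fz}         {fs (fs fz)} ()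
  neighbourSum-G-injective {fs fz}      {fz}         ()
  neighbourSum-G-injective {fs fz}      {fs (fs fz)} ()
  neighbourSum-G-injective {fs (fs fz)} {fz}         ()
  neighbourSum-G-injective {fs (fs fz)} {fs fz}      ()

  W-↑ˡ-injective : Injective _≡_ _≡_ (W ∘ (_↑ˡ V H))
  W-↑ˡ-injective {i} {j} e =
    neighbourSum-G-injective (+-cancelʳ-≡ T _ _ (trans (sym (W-↑ˡ i)) (trans e (W-↑ˡ j))))

  W-↑ʳ-injective : Injective _≡_ _≡_ (W ∘ (V G ↑ʳ_))
  W-↑ʳ-injective {k} {l} e =
    partner-injective N (↑ʳ-injective (V G) _ _ (toℕ-injective (suc-injective
      (+-cancelˡ-≡ 6 _ _ (trans (sym (W-↑ʳ k)) (trans e (W-↑ʳ l)))))))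

  V[H]*4≤T : V H * 4 ≤ T
  V[H]*4≤T = *≤∑ (V H) 4 _ λ j → subst (4 ≤_) (cong suc (sym (toℕ-↑ʳ (V G) j))) (m≤m+n 4 (toℕ j))

  W-↑ʳ<T : (k : Fin (V H)) → W (V G ↑ʳ k) < T
  W-↑ʳ<T k = begin-strict
    W (V G ↑ʳ k)                ≡⟨ W-↑ʳ k ⟩
    6 + ℓ (V G ↑ʳ partner N k)  ≡⟨ cong (7 +_) (toℕ-↑ʳ (V G) (partner N k)) ⟩
    10 + toℕ (partner N k)      <⟨ +-monoʳ-< 10 (toℕ<n (partner N k)) ⟩
    10 + V H                    ≤⟨ +-mono-≤ (m≤m+n 14 2) (m≤m*n (V (copies n Γ₉)) 4) ⟩
    V H * 4                     ≤⟨ V[H]*4≤T ⟩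
    T                           ∎
    where open ≤-Reasoning

  W-injective : Injective _≡_ _≡_ W
  W-injective = injective-↑ (V G) (V H) W W-↑ˡ-injective W-↑ʳ-injective
    λ i k → <-≤-trans (W-↑ʳ<T k) (subst (T ≤_) (sym (W-↑ˡ i)) (m≤n+m T _))

  daml : AdmitsDAML (G ⊞ H)
  daml = id , Identity.bijective _≡_ , W-injective

Γ₆ᶜ⊞copies-DAML : (n : ℕ) → n ≥ 1 → AdmitsDAML (copies 1 Γ₆ᶜ ⊞ copies n Γ₉)
Γ₆ᶜ⊞copies-DAML (suc zero)    _ = Γ₆ᶜ⊞Γ₉-DAML
Γ₆ᶜ⊞copies-DAML (suc (suc n)) _ = IdentityLabeling.daml n

theorem2p8 : (m n : ℕ) → m ≥ 1 → n ≥ 1 →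
    (AdmitsDAML (copies m (complement (Γℤ 6)) ⊞ copies n (Γℤ 9)) ⇔ (m ≡ 1))
theorem2p8 (suc zero)    n _ n≥1 = mk⇔ (λ _ → refl) (λ _ → Γ₆ᶜ⊞copies-DAML n n≥1)
theorem2p8 (suc (suc m)) n _ _   =
  mk⇔ (λ daml → ⊥-elim (copies-⊞-¬DAML Γ₆ᶜ (copies n Γ₉) m {fs fz} Γ₆ᶜ-isolated daml)) λ ()
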